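{- For all integers $j\geq 2$ and $n\geq 2$, \[ m_j(K_{1,2}, P_4, nK_2)\geq\left\lfloor \frac{2n}{j} \right\rfloor+1. \]
   Context: All graphs are finite, simple and undirected. $K_{j\times t}$ denotes the complete multipartite graph with $j$ partite classes, each of size $t$. For graphs $G_1,\dots,G_k$ and an integer $j$, $m_j(G_1,\dots,G_k)$ is the smallest positive integer $t$ such that every $k$-coloring of the edges of $K_{j\times t}$ contains, for some $i$, a copy of $G_i$ all of whose edges have color $i$. $K_{1,2}$ is the path on 3 vertices, $P_4$ the path on 4 vertices, and $nK_2$ the matching of $n$ disjoint edges. -}

module Defs where

open import Data.Nat using (ℕ; zero; suc; _<_)
open import Data.Fin using (Fin; toℕ)
open import Data.Product using (Σ; _×_; _,_; proj₁; ∃)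
open import Data.Sum using (_⊎_)
open import Relation.Binary.PropositionalEquality using (_≡_; _≢_)
open import Function.Definitions using (Injective)
open import Data.Vec using (Vec; lookup; _∷_; [])

record Graph : Set₁ where
  field
    size : ℕ
    Adj  : Fin size → Fin size → Set
open Graph public

K12 : Graph
K12 = record
  { size = 3
  ; Adj  = λ u v → (toℕ u ≡ 0 × toℕ v ≢ 0) ⊎ (toℕ v ≡ 0 × toℕ u ≢ 0) }

Path : ℕ → Graph
Path m = record
  { size = m
  ; Adj  = λ u v → (suc (toℕ u) ≡ toℕ v) ⊎ (suc (toℕ v) ≡ toℕ u) }

P4 : Graph
P4 = Path 4

-- n K_2: vertices 0..2n-1, with edges {2i, 2i+1}.
half : ℕ → ℕ
half zero = zero
half (suc zero) = zero
half (suc (suc k)) = suc (half k)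

Matching : ℕ → Graph
Matching n = record
  { size = n Data.Nat.+ n
  ; Adj  = λ u v → half (toℕ u) ≡ half (toℕ v) × toℕ u ≢ toℕ v }

-- Vertices of K_{j×t}: (partite class, index within class).
KVertex : ℕ → ℕ → Set
KVertex j t = Fin j × Fin t

KAdj : ∀ {j t} → KVertex j t → KVertex j t → Set
KAdj u v = proj₁ u ≢ proj₁ v

-- A k-colouring of the edges of K_{j×t}: a symmetric colour function on
-- vertex pairs (its values on non-edges are irrelevant).
record EdgeColouring (k j t : ℕ) : Set where
  field
    colour : KVertex j t → KVertex j t → Fin k
    sym    : ∀ u v → colour u v ≡ colour v u
open EdgeColouring public

MonoCopy : ∀ {k j t} → EdgeColouring k j t → Fin k → Graph → Set
MonoCopy {k} {j} {t} χ i G =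
  Σ (Fin (size G) → KVertex j t) λ f →
    Injective _≡_ _≡_ f ×
    (∀ u v → Adj G u v → KAdj (f u) (f v) × colour χ (f u) (f v) ≡ i)

Arrows : ∀ {k} → ℕ → ℕ → Vec Graph k → Set
Arrows {k} j t Gs = (χ : EdgeColouring k j t) → ∃ λ (i : Fin k) → MonoCopy χ i (lookup Gs i)

-- "m_j(G_1,…,G_k) ≥ N": every positive t with the arrowing property is ≥ N
-- (equivalently, the least such t, if any, is ≥ N).
MultipartiteRamseyAtLeast : ∀ {k} → ℕ → Vec Graph k → ℕ → Set
MultipartiteRamseyAtLeast j Gs N = ∀ t → 1 Data.Nat.≤ t → Arrows j t Gs → N Data.Nat.≤ t

{-# OPTIONS --safe #-}
module Submission where

-- Fix a vertex c of K_{j×t}; give the edges at c the P₄ colour and all other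
-- edges the matching colour, leaving the K_{1,2} colour unused.  Every edge of
-- the P₄ colour contains c, while P₄ has two disjoint edges, so there is no P₄.
-- A copy of nK₂ in the matching colour cannot use c, so it needs 2n ≤ jt - 1.
-- Hence if K_{j×t} arrows the triple then 2n < jt, that is ⌊2n/j⌋ < t.

open import Defs hiding (sym)
open import Data.Nat using (ℕ; zero; suc; _+_; _*_; _/_; _≤_; _<_; NonZero; >-nonZero⁻¹; s≤s; z≤n)
open import Data.Nat.DivMod using (m<n*o⇒m/o<n)
open import Data.Nat.Properties using (+-comm; *-comm; +-identityʳ; +-suc; ≤-pred; suc-injective)
open import Data.Fin using (Fin; toℕ; fromℕ<; combine; punchOut; _≟_) renaming (zero to fz; suc to fs)
open import Data.Fin.Properties using (toℕ-fromℕ<; toℕ<n; combine-injective; punchOut-injective; injective⇒≤)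
open import Data.Bool using (Bool; true; false; _∨_; if_then_else_)
open import Data.Bool.Properties using (∨-comm)
open import Data.Product using (_×_; _,_; proj₂; ∃; uncurry)
open import Data.Product.Properties using (≡-dec)
open import Data.Sum using (_⊎_; inj₁; inj₂)
open import Data.Vec using (_∷_; [])
open import Data.Empty using (⊥-elim)
open import Function.Definitions using (Injective)
open import Relation.Nullary using (¬_; does; yes; no)
open import Relation.Binary.Definitions using (DecidableEquality)
open import Relation.Binary.PropositionalEquality
  using (_≡_; _≢_; refl; sym; trans; cong; cong₂; subst; subst₂; ≢-sym)

injective-avoiding⇒< : ∀ {m n} {f : Fin m → Fin n} (c : Fin n) →
  Injective _≡_ _≡_ f → (∀ x → f x ≢ c) → m < n
injective-avoiding⇒< {n = suc _} {f} c f-inj f≢c =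
  s≤s (injective⇒≤ {f = λ x → punchOut (≢-sym (f≢c x))}
        (λ {x} {y} eq → f-inj (punchOut-injective (≢-sym (f≢c x)) (≢-sym (f≢c y)) eq)))

vertexIndex : ∀ {j t} → KVertex j t → Fin (j * t)
vertexIndex = uncurry combine

vertexIndex-injective : ∀ {j t} → Injective _≡_ _≡_ (vertexIndex {j} {t})
vertexIndex-injective {x = p , q} {y = r , s} eq = uncurry (cong₂ _,_) (combine-injective p q r s eq)

vertexMap-avoiding⇒< : ∀ {m j t} {f : Fin m → KVertex j t} (c : KVertex j t) →
  Injective _≡_ _≡_ f → (∀ x → f x ≢ c) → m < j * t
vertexMap-avoiding⇒< c f-inj f≢c =
  injective-avoiding⇒< (vertexIndex c) (λ eq → f-inj (vertexIndex-injective eq))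
    (λ x eq → f≢c x (vertexIndex-injective eq))

_≟ᵥ_ : ∀ {j t} → DecidableEquality (KVertex j t)
_≟ᵥ_ = ≡-dec _≟_ _≟_

module Star {k j t : ℕ} (c : KVertex j t) (a b : Fin k) where

  touches : KVertex j t → KVertex j t → Bool
  touches u v = does (u ≟ᵥ c) ∨ does (v ≟ᵥ c)

  starColouring : EdgeColouring k j t
  starColouring = record
    { colour = λ u v → if touches u v then a else b
    ; sym    = λ u v → cong (λ x → if x then a else b) (∨-comm (does (u ≟ᵥ c)) (does (v ≟ᵥ c)))
    }

  colour-≡a⊎≡b : ∀ u v → colour starColouring u v ≡ a ⊎ colour starColouring u v ≡ b
  colour-≡a⊎≡b u v with touches u v
  ... | true  = inj₁ refl
  ... | false = inj₂ refl

  colour≡a⇒touches : a ≢ b → ∀ u v → colour starColouring u v ≡ a → u ≡ c ⊎ v ≡ c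
  colour≡a⇒touches a≢b u v eq with u ≟ᵥ c | v ≟ᵥ c
  ... | yes u≡c | _       = inj₁ u≡c
  ... | no _    | yes v≡c = inj₂ v≡c
  ... | no _    | no _    = ⊥-elim (a≢b (sym eq))

  colour≡b⇒≢c : a ≢ b → ∀ u v → colour starColouring u v ≡ b → u ≢ c
  colour≡b⇒≢c a≢b u v eq u≡c with u ≟ᵥ c
  ... | yes _   = a≢b eq
  ... | no u≢c  = u≢c u≡c

  noCopy-otherColour : ∀ {G i x y} → i ≢ a → i ≢ b → Adj G x y → ¬ MonoCopy starColouring i G
  noCopy-otherColour i≢a i≢b xy (f , _ , mono) with colour-≡a⊎≡b (f _) (f _) | proj₂ (mono _ _ xy)
  ... | inj₁ ≡a | ≡i = i≢a (trans (sym ≡i) ≡a)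
  ... | inj₂ ≡b | ≡i = i≢b (trans (sym ≡i) ≡b)

  noCopy-twoDisjointEdges : a ≢ b → ∀ {G x y z w} → Adj G x y → Adj G z w →
    x ≢ z → x ≢ w → y ≢ z → y ≢ w → ¬ MonoCopy starColouring a G
  noCopy-twoDisjointEdges a≢b xy zw x≢z x≢w y≢z y≢w (f , f-inj , mono)
    with colour≡a⇒touches a≢b _ _ (proj₂ (mono _ _ xy))
       | colour≡a⇒touches a≢b _ _ (proj₂ (mono _ _ zw))
  ... | inj₁ fx≡c | inj₁ fz≡c = x≢z (f-inj (trans fx≡c (sym fz≡c)))
  ... | inj₁ fx≡c | inj₂ fw≡c = x≢w (f-inj (trans fx≡c (sym fw≡c)))
  ... | inj₂ fy≡c | inj₁ fz≡c = y≢z (f-inj (trans fy≡c (sym fz≡c)))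
  ... | inj₂ fy≡c | inj₂ fw≡c = y≢w (f-inj (trans fy≡c (sym fw≡c)))

  copy-size< : a ≢ b → ∀ {G} → (∀ x → ∃ (Adj G x)) → MonoCopy starColouring b G → size G < j * t
  copy-size< a≢b neighbour (f , f-inj , mono) =
    vertexMap-avoiding⇒< c f-inj
      (λ x → let y , xy = neighbour x in colour≡b⇒≢c a≢b (f x) (f y) (proj₂ (mono x y xy)))

mate : ℕ → ℕ
mate zero          = 1
mate (suc zero)    = 0
mate (suc (suc k)) = suc (suc (mate k))

half-mate : ∀ k → half (mate k) ≡ half k
half-mate zero          = refl
half-mate (suc zero)    = refl
half-mate (suc (suc k)) = cong suc (half-mate k)

mate≢ : ∀ k → k ≢ mate k
mate≢ zero          ()
mate≢ (suc zero)    ()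
mate≢ (suc (suc k)) eq = mate≢ k (suc-injective (suc-injective eq))

mate< : ∀ n k → k < n + n → mate k < n + n
mate< (suc n) zero          _ rewrite +-suc n n = s≤s (s≤s z≤n)
mate< (suc n) (suc zero)    _ = s≤s z≤n
mate< (suc n) (suc (suc k)) k< rewrite +-suc n n =
  s≤s (s≤s (mate< n k (≤-pred (≤-pred k<))))

matching-neighbour : ∀ n (u : Fin (n + n)) → ∃ (Adj (Matching n) u)
matching-neighbour n u = fromℕ< mate-u< , subst (λ m → half (toℕ u) ≡ half m × toℕ u ≢ m)
  (sym (toℕ-fromℕ< mate-u<)) (sym (half-mate (toℕ u)) , mate≢ (toℕ u))
  where
  mate-u< : mate (toℕ u) < n + n
  mate-u< = mate< n (toℕ u) (toℕ<n u)

module _ {j t : ℕ} (n : ℕ) (c : KVertex j t) where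
  open Star {k = 3} c (fs fz) (fs (fs fz))

  arrows⇒2n<jt : Arrows j t (K12 ∷ P4 ∷ Matching n ∷ []) → n + n < j * t
  arrows⇒2n<jt arrows with arrows starColouring
  ... | fz , copy =
    ⊥-elim (noCopy-otherColour {x = fz} {fs fz} (λ ()) (λ ()) (inj₁ (refl , λ ())) copy)
  ... | fs fz , copy =
    ⊥-elim (noCopy-twoDisjointEdges (λ ()) {x = fz} {fs fz} {fs (fs fz)} {fs (fs (fs fz))}
              (inj₁ refl) (inj₁ refl) (λ ()) (λ ()) (λ ()) (λ ()) copy)
  ... | fs (fs fz) , copy = copy-size< (λ ()) (matching-neighbour n) copy

theorem3 : (j n : ℕ) → .{{_ : NonZero j}} → 2 ≤ j → 2 ≤ n →
    MultipartiteRamseyAtLeast j (K12 ∷ P4 ∷ Matching n ∷ []) ((2 * n) / j + 1)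
theorem3 j n _ _ t t≥1 arrows =
  subst (_≤ t) (+-comm 1 ((2 * n) / j)) (m<n*o⇒m/o<n 2n<t*j)
  where
  2n<t*j : 2 * n < t * j
  2n<t*j = subst₂ _<_ (cong (n +_) (sym (+-identityʳ n))) (*-comm j t)
             (arrows⇒2n<jt n (vertex (>-nonZero⁻¹ j) t≥1) arrows)
    where
    vertex : 1 ≤ j → 1 ≤ t → KVertex j t
    vertex (s≤s _) (s≤s _) = fz , fz
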